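{- Let $n\ge 1$ and $d\ge 1$. Let $C^d_n$ be the poset of iterated compositions of $n$ of degree $d$, i.e. $d$-tuples $(\pi_1,\dots,\pi_d)$ of compositions of $n$ with $\pi_1\preceq\pi_2\preceq\cdots\preceq\pi_d$, ordered componentwise. Then $C^d_n$ is isomorphic to a direct product of $n-1$ chains, each of cardinality $d+1$.
   Context: A composition of $n$ is an ordered tuple of positive integers summing to $n$, identified with the set-partition of $[n]$ into consecutive intervals of these lengths; $\pi\preceq\sigma$ (refinement) means every block of $\pi$ is contained in a block of $\sigma$. -}

module Defs where

open import Data.Nat using (ℕ; zero; suc; _+_; _∸_; _≤_; _<_)
open import Data.List using (List; []; _∷_)
open import Data.Nat.ListAction using (sum)
open import Data.List.Relation.Unary.All using (All)
open import Data.List.Membership.Propositional using (_∈_)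
open import Data.Vec using (Vec; lookup)
open import Data.Fin using (Fin; toℕ)
import Data.Fin as F
open import Data.Product using (_×_; _,_; Σ; ∃-syntax)
open import Relation.Binary.PropositionalEquality using (_≡_)

IsComposition : ℕ → List ℕ → Set
IsComposition n c = All (λ a → 0 < a) c × sum c ≡ n

Block : Set
Block = ℕ × ℕ

_∈B_ : ℕ → Block → Set
i ∈B (s , e) = s ≤ i × i < e

blocksFrom : ℕ → List ℕ → List Block
blocksFrom s []      = []
blocksFrom s (a ∷ c) = (s , s + a) ∷ blocksFrom (s + a) c

blocks : List ℕ → List Block
blocks = blocksFrom 0

_⪯_ : List ℕ → List ℕ → Set
π ⪯ σ = ∀ b → b ∈ blocks π → ∃[ b' ] (b' ∈ blocks σ × (∀ i → i ∈B b → i ∈B b'))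

IsIteratedComposition : (n d : ℕ) → Vec (List ℕ) d → Set
IsIteratedComposition n d v =
  (∀ (i : Fin d) → IsComposition n (lookup v i)) ×
  (∀ (i j : Fin d) → toℕ j ≡ suc (toℕ i) → lookup v i ⪯ lookup v j)

_≤C_ : ∀ {d} → Vec (List ℕ) d → Vec (List ℕ) d → Set
v ≤C w = ∀ i → lookup v i ⪯ lookup w i

_≤P_ : ∀ {m k} → Vec (Fin k) m → Vec (Fin k) m → Set
p ≤P q = ∀ i → lookup p i F.≤ lookup q i

record OrderIso {A B : Set} (P : A → Set) (_≤A_ : A → A → Set)
                (_≤B_ : B → B → Set) : Set where
  field
    to      : (a : A) → P a → B
    from    : B → A
    from-P  : ∀ b → P (from b)
    from-to : ∀ a (pa : P a) → from (to a pa) ≡ a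
    to-from : ∀ b → to (from b) (from-P b) ≡ b
    to-mono : ∀ a a' (pa : P a) (pa' : P a') → a ≤A a' → to a pa ≤B to a' pa'
    to-refl : ∀ a a' (pa : P a) (pa' : P a') → to a pa ≤B to a' pa' → a ≤A a'

module Submission where

-- A composition of n is determined by its cuts, the block starts among the
-- positions 1, …, n-1, and π ⪯ σ holds exactly when every cut of σ is a cut of π.
-- So an iterated composition is a decreasing chain of d sets of cuts, and for a
-- fixed position k the indices i at which k is a cut of πᵢ form an initial
-- segment of Fin d.  Such a segment is determined by the number of indices
-- outside it, a value in {0, …, d}; taking this number at each of the n-1
-- positions is monotone in both directions.

open import Defs
open import Data.Bool using (Bool; true; false; T; _∨_; if_then_else_)
open import Data.Bool.Properties using (T-∨; T-≡)
open import Data.Empty using (⊥-elim)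
open import Data.Fin using (Fin; zero; suc; toℕ; inject₁; fromℕ<)
open import Data.Fin.Properties using (toℕ-injective; toℕ≤pred[n]; toℕ-inject₁; toℕ-fromℕ<)
open import Data.List using (List; []; _∷_)
open import Data.List.Membership.Propositional using (_∈_)
open import Data.List.Relation.Unary.All using (All; []; _∷_)
open import Data.List.Relation.Unary.Any using (here; there)
open import Data.Nat
  using (ℕ; zero; suc; _+_; _∸_; _≤_; _<_; z≤n; s≤s; z<s; s≤s⁻¹; _≡ᵇ_; _<ᵇ_; _<?_)
open import Data.Nat.ListAction using (sum)
open import Data.Nat.Properties
open import Data.Product using (_×_; _,_; proj₁; proj₂; ∃-syntax)
open import Data.Sum using (_⊎_; inj₁; inj₂)
import Data.Sum as Sum
open import Data.Vec using (Vec; []; _∷_; lookup; tabulate)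
open import Data.Vec.Properties using (lookup∘tabulate; tabulate∘lookup; tabulate-cong)
open import Function using (_∘_; Equivalence)
open import Relation.Nullary using (¬_; yes; no)
open import Relation.Binary.PropositionalEquality

¬T⇒≡false : ∀ {x} → ¬ T x → x ≡ false
¬T⇒≡false {false} _ = refl
¬T⇒≡false {true}  h = ⊥-elim (h _)

Positive : List ℕ → Set
Positive = All (0 <_)

isStart : ℕ → List ℕ → ℕ → Bool
isStart s []      x = false
isStart s (a ∷ c) x = (s ≡ᵇ x) ∨ isStart (s + a) c x

isStart-here : ∀ s a c → T (isStart s (a ∷ c) s)
isStart-here s a c = Equivalence.from T-∨ (inj₁ (≡⇒≡ᵇ s s refl))

isStart-there : ∀ s a c {x} → T (isStart (s + a) c x) → T (isStart s (a ∷ c) x)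
isStart-there s a c {x} h = Equivalence.from (T-∨ {s ≡ᵇ x}) (inj₂ h)

isStart-∷ : ∀ s a c {x} → T (isStart s (a ∷ c) x) → x ≡ s ⊎ T (isStart (s + a) c x)
isStart-∷ s a c {x} h = Sum.map₁ (sym ∘ ≡ᵇ⇒≡ s x) (Equivalence.to T-∨ h)

isStart-suc : ∀ s c x → isStart (suc s) c (suc x) ≡ isStart s c x
isStart-suc s []      x = refl
isStart-suc s (a ∷ c) x = cong ((s ≡ᵇ x) ∨_) (isStart-suc (s + a) c x)

isStart-≥ : ∀ s c x → T (isStart s c x) → s ≤ x
isStart-≥ s (a ∷ c) x h with isStart-∷ s a c h
... | inj₁ refl = ≤-refl
... | inj₂ h′   = ≤-trans (m≤m+n s a) (isStart-≥ (s + a) c x h′)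

isStart-< : ∀ s {c} x → Positive c → T (isStart s c x) → x < s + sum c
isStart-< s {a ∷ c} x (a>0 ∷ pc) h with isStart-∷ s a c h
... | inj₁ refl = m<m+n s (<-≤-trans a>0 (m≤m+n a (sum c)))
... | inj₂ h′   = subst (x <_) (+-assoc s a (sum c)) (isStart-< (s + a) x pc h′)

isStart-0 : ∀ {n c} → IsComposition (suc n) c → T (isStart 0 c 0)
isStart-0 {c = []}    (_ , ())
isStart-0 {c = a ∷ c} _ = _

record BlockFacts (s : ℕ) (c : List ℕ) (l r : ℕ) : Set where
  field
    start-≥           : s ≤ l
    nonempty          : l < r
    end-≤             : r ≤ s + sum c
    start-isStart     : T (isStart s c l)
    interior-¬isStart : ∀ x → l < x → x < r → ¬ T (isStart s c x)
    end-isStart       : r < s + sum c → T (isStart s c r)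

open BlockFacts

blockFacts : ∀ {s c l r} → Positive c → (l , r) ∈ blocksFrom s c → BlockFacts s c l r
blockFacts {s} {a ∷ c} (a>0 ∷ _) (here refl) = record
  { start-≥           = ≤-refl
  ; nonempty          = m<m+n s a>0
  ; end-≤             = subst (s + a ≤_) (+-assoc s a (sum c)) (m≤m+n (s + a) (sum c))
  ; start-isStart     = isStart-here s a c
  ; interior-¬isStart = interior
  ; end-isStart       = end c
  }
  where
  interior : ∀ x → s < x → x < s + a → ¬ T (isStart s (a ∷ c) x)
  interior x s<x x<s+a h with isStart-∷ s a c h
  ... | inj₁ refl = <-irrefl refl s<x
  ... | inj₂ h′   = <⇒≱ x<s+a (isStart-≥ (s + a) c x h′)
  end : ∀ c → s + a < s + sum (a ∷ c) → T (isStart s (a ∷ c) (s + a))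
  end []      s+a<s+a+0 = ⊥-elim (<-irrefl (cong (s +_) (sym (+-identityʳ a))) s+a<s+a+0)
  end (b ∷ c) _         = isStart-there s a (b ∷ c) (isStart-here (s + a) b c)
blockFacts {s} {a ∷ c} {l} {r} (_ ∷ pc) (there b∈c) = record
  { start-≥           = ≤-trans (m≤m+n s a) (start-≥ facts)
  ; nonempty          = nonempty facts
  ; end-≤             = subst (r ≤_) (+-assoc s a (sum c)) (end-≤ facts)
  ; start-isStart     = isStart-there s a c (start-isStart facts)
  ; interior-¬isStart = interior
  ; end-isStart       =
      isStart-there s a c ∘ end-isStart facts ∘ subst (r <_) (sym (+-assoc s a (sum c)))
  }
  where
  facts : BlockFacts (s + a) c l r
  facts = blockFacts pc b∈c
  interior : ∀ x → l < x → x < r → ¬ T (isStart s (a ∷ c) x)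
  interior x l<x x<r h with isStart-∷ s a c h
  ... | inj₁ refl = <⇒≱ l<x (≤-trans (m≤m+n s a) (start-≥ facts))
  ... | inj₂ h′   = interior-¬isStart facts x l<x x<r h′

blocksFrom-cover : ∀ s c x → s ≤ x → x < s + sum c → ∃[ b ] (b ∈ blocksFrom s c × x ∈B b)
blocksFrom-cover s []      x s≤x x<s+0 = ⊥-elim (<⇒≱ x<s+0 (subst (_≤ x) (sym (+-identityʳ s)) s≤x))
blocksFrom-cover s (a ∷ c) x s≤x x<end with x <? s + a
... | yes x<s+a = (s , s + a) , here refl , s≤x , x<s+a
... | no  x≮s+a
  with blocksFrom-cover (s + a) c x (≮⇒≥ x≮s+a) (subst (x <_) (sym (+-assoc s a (sum c))) x<end)
...   | b , b∈c , x∈b = b , there b∈c , x∈b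

module _ {n π σ} (cπ : IsComposition n π) (cσ : IsComposition n σ) where

  private
    pπ : Positive π
    pπ = proj₁ cπ
    pσ : Positive σ
    pσ = proj₁ cσ
    sum-π≡sum-σ : sum π ≡ sum σ
    sum-π≡sum-σ = trans (proj₂ cπ) (sym (proj₂ cσ))

  ⪯⇒starts⊇ : π ⪯ σ → ∀ x → T (isStart 0 σ x) → T (isStart 0 π x)
  ⪯⇒starts⊇ π⪯σ x x∈σ
    with blocksFrom-cover 0 π x z≤n (subst (x <_) (sym sum-π≡sum-σ) (isStart-< 0 x pσ x∈σ))
  ... | (l , r) , b∈π , l≤x , x<r with m≤n⇒m<n∨m≡n l≤x
  ...   | inj₂ refl = start-isStart (blockFacts pπ b∈π)
  ...   | inj₁ l<x with π⪯σ (l , r) b∈π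
  ...     | (l′ , r′) , b′∈σ , b⊆b′ =
    ⊥-elim (interior-¬isStart (blockFacts pσ b′∈σ) x l′<x (proj₂ (b⊆b′ x (l≤x , x<r))) x∈σ)
    where
    -- the σ-block containing the π-block of x would have x strictly inside it
    l′<x : l′ < x
    l′<x = ≤-<-trans (proj₁ (b⊆b′ l (≤-refl , nonempty (blockFacts pπ b∈π)))) l<x

  starts⊇⇒⪯ : (∀ x → T (isStart 0 σ x) → T (isStart 0 π x)) → π ⪯ σ
  starts⊇⇒⪯ σ⊆π (l , r) b∈π with blockFacts pπ b∈π
  ... | facts
    with blocksFrom-cover 0 σ l z≤n
           (subst (l <_) sum-π≡sum-σ (<-≤-trans (nonempty facts) (end-≤ facts)))
  ...   | (l′ , r′) , b′∈σ , l′≤l , l<r′ with r ≤? r′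
  ...     | yes r≤r′ =
    (l′ , r′) , b′∈σ , λ i (l≤i , i<r) → ≤-trans l′≤l l≤i , <-≤-trans i<r r≤r′
  ...     | no  r≰r′ =
    ⊥-elim (interior-¬isStart facts r′ l<r′ r′<r
              (σ⊆π r′ (end-isStart (blockFacts pσ b′∈σ) r′<n)))
    where
    -- otherwise the σ-block through l ends strictly inside the π-block, at a start of σ
    r′<r : r′ < r
    r′<r = ≰⇒> r≰r′
    r′<n : r′ < sum σ
    r′<n = subst (r′ <_) sum-π≡sum-σ (<-≤-trans r′<r (end-≤ facts))

first-part-≤ : ∀ s {a b π σ} → Positive (a ∷ π) → Positive (b ∷ σ) →
               sum (a ∷ π) ≡ sum (b ∷ σ) →
               (∀ x → T (isStart s (b ∷ σ) x) → T (isStart s (a ∷ π) x)) → a ≤ b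
first-part-≤ s {a} {b} {π} pπ pσ@(b>0 ∷ _) eq σ⊆π = ≮⇒≥ λ b<a →
  interior-¬isStart (blockFacts pπ (here refl)) (s + b) (m<m+n s b>0) (+-monoʳ-< s b<a)
    (σ⊆π (s + b) (end-isStart (blockFacts pσ (here refl))
      (+-monoʳ-< s (subst (b <_) eq (<-≤-trans b<a (m≤m+n a (sum π)))))))

starts⊆-tail : ∀ s {a} π σ → 0 < a →
               (∀ x → T (isStart s (a ∷ π) x) → T (isStart s (a ∷ σ) x)) →
               ∀ x → T (isStart (s + a) π x) → T (isStart (s + a) σ x)
starts⊆-tail s {a} π σ a>0 π⊆σ x x∈π with isStart-∷ s a σ (π⊆σ x (isStart-there s a π x∈π))
... | inj₁ refl = ⊥-elim (<⇒≱ (m<m+n s a>0) (isStart-≥ (s + a) π s x∈π))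
... | inj₂ x∈σ = x∈σ

isStart-injective : ∀ s {π σ} → Positive π → Positive σ → sum π ≡ sum σ →
                    (∀ x → T (isStart s π x) → T (isStart s σ x)) →
                    (∀ x → T (isStart s σ x) → T (isStart s π x)) → π ≡ σ
isStart-injective s {[]}    {[]}    _ _ _ _ _ = refl
isStart-injective s {[]}    {b ∷ σ} _ _ _ _ σ⊆π = ⊥-elim (σ⊆π s (isStart-here s b σ))
isStart-injective s {a ∷ π} {[]}    _ _ _ π⊆σ _ = ⊥-elim (π⊆σ s (isStart-here s a π))
isStart-injective s {a ∷ π} {b ∷ σ} pπ@(a>0 ∷ pπ′) pσ@(_ ∷ pσ′) eq π⊆σ σ⊆π
  with ≤-antisym (first-part-≤ s pπ pσ eq σ⊆π) (first-part-≤ s pσ pπ (sym eq) π⊆σ)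
... | refl = cong (a ∷_) (isStart-injective (s + a) pπ′ pσ′ (+-cancelˡ-≡ a (sum π) (sum σ) eq)
                            (starts⊆-tail s π σ a>0 π⊆σ) (starts⊆-tail s σ π a>0 σ⊆π))

-- The positions 1, …, m at which a block of a composition of suc m may start
-- are indexed by Fin m.
cutAt : ∀ {m} → List ℕ → Fin m → Bool
cutAt c k = isStart 0 c (suc (toℕ k))

growFirst : List ℕ → List ℕ
growFirst []      = 1 ∷ []
growFirst (a ∷ c) = suc a ∷ c

growFirst-isComposition : ∀ {n c} → IsComposition n c → IsComposition (suc n) (growFirst c)
growFirst-isComposition {c = []}    (_ , refl)         = z<s ∷ [] , refl
growFirst-isComposition {c = a ∷ c} (_ ∷ pos , sum≡) = z<s ∷ pos , cong suc sum≡

fromCuts : ∀ {m} → Vec Bool m → List ℕ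
fromCuts []           = 1 ∷ []
fromCuts (true ∷ bs)  = 1 ∷ fromCuts bs
fromCuts (false ∷ bs) = growFirst (fromCuts bs)

fromCuts-isComposition : ∀ {m} (bs : Vec Bool m) → IsComposition (suc m) (fromCuts bs)
fromCuts-isComposition []           = z<s ∷ [] , refl
fromCuts-isComposition (true ∷ bs)  with fromCuts-isComposition bs
... | pos , sum≡ = z<s ∷ pos , cong suc sum≡
fromCuts-isComposition (false ∷ bs) = growFirst-isComposition (fromCuts-isComposition bs)

cutAt-growFirst-zero : ∀ {m c} → Positive c → cutAt {suc m} (growFirst c) zero ≡ false
cutAt-growFirst-zero {c = []}    _         = refl
cutAt-growFirst-zero {c = a ∷ c} (a>0 ∷ _) =
  trans (isStart-suc a c 0) (¬T⇒≡false (<⇒≱ a>0 ∘ isStart-≥ a c 0))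

cutAt-growFirst-suc : ∀ {m} c (k : Fin m) → cutAt (growFirst c) (suc k) ≡ cutAt c k
cutAt-growFirst-suc []      k = refl
cutAt-growFirst-suc (a ∷ c) k = isStart-suc a c (suc (toℕ k))

cutAt-1∷-suc : ∀ {m} c (k : Fin m) → cutAt (1 ∷ c) (suc k) ≡ cutAt c k
cutAt-1∷-suc c k = isStart-suc 0 c (suc (toℕ k))

cutAt-fromCuts : ∀ {m} (bs : Vec Bool m) k → cutAt (fromCuts bs) k ≡ lookup bs k
cutAt-fromCuts (true ∷ bs)  zero    =
  trans (isStart-suc 0 (fromCuts bs) 0) (Equivalence.to T-≡ (isStart-0 (fromCuts-isComposition bs)))
cutAt-fromCuts (true ∷ bs)  (suc k) = trans (cutAt-1∷-suc (fromCuts bs) k) (cutAt-fromCuts bs k)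
cutAt-fromCuts {suc m} (false ∷ bs) zero =
  cutAt-growFirst-zero {m} (proj₁ (fromCuts-isComposition bs))
cutAt-fromCuts (false ∷ bs) (suc k) = trans (cutAt-growFirst-suc (fromCuts bs) k) (cutAt-fromCuts bs k)

module _ {m π σ} (cπ : IsComposition (suc m) π) (cσ : IsComposition (suc m) σ) where

  cutAt⊇⇒starts⊇ : (∀ (k : Fin m) → T (cutAt σ k) → T (cutAt π k)) →
                   ∀ x → T (isStart 0 σ x) → T (isStart 0 π x)
  cutAt⊇⇒starts⊇ σ⊆π zero    _   = isStart-0 cπ
  cutAt⊇⇒starts⊇ σ⊆π (suc y) y∈σ =
    subst (λ z → T (isStart 0 π (suc z))) toℕ-k
          (σ⊆π k (subst (λ z → T (isStart 0 σ (suc z))) (sym toℕ-k) y∈σ))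
    where
    y<m : y < m
    y<m = s≤s⁻¹ (subst (suc y <_) (proj₂ cσ) (isStart-< 0 (suc y) (proj₁ cσ) y∈σ))
    k : Fin m
    k = fromℕ< y<m
    toℕ-k : toℕ k ≡ y
    toℕ-k = toℕ-fromℕ< y<m

  ⪯⇒cutAt⊇ : π ⪯ σ → ∀ (k : Fin m) → T (cutAt σ k) → T (cutAt π k)
  ⪯⇒cutAt⊇ π⪯σ k = ⪯⇒starts⊇ cπ cσ π⪯σ (suc (toℕ k))

  cutAt⊇⇒⪯ : (∀ (k : Fin m) → T (cutAt σ k) → T (cutAt π k)) → π ⪯ σ
  cutAt⊇⇒⪯ = starts⊇⇒⪯ cπ cσ ∘ cutAt⊇⇒starts⊇

fromCuts-cutAt : ∀ {m c} (bs : Vec Bool m) → IsComposition (suc m) c →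
                 (∀ k → cutAt c k ≡ lookup bs k) → fromCuts bs ≡ c
fromCuts-cutAt bs cc same =
  isStart-injective 0 (proj₁ cbs) (proj₁ cc) (trans (proj₂ cbs) (sym (proj₂ cc)))
  (cutAt⊇⇒starts⊇ cc cbs λ k → subst T (trans (cutAt-fromCuts bs k) (sym (same k))))
  (cutAt⊇⇒starts⊇ cbs cc λ k → subst T (trans (same k) (sym (cutAt-fromCuts bs k))))
  where
  cbs : IsComposition _ (fromCuts bs)
  cbs = fromCuts-isComposition bs

countFalse : ∀ {d} → (Fin d → Bool) → Fin (suc d)
countFalse {zero}  f = zero
countFalse {suc d} f =
  if f zero then inject₁ (countFalse (f ∘ suc)) else suc (countFalse (f ∘ suc))

countFalse-cong : ∀ {d} {f g : Fin d → Bool} → (∀ i → f i ≡ g i) → countFalse f ≡ countFalse g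
countFalse-cong {zero}  _   = refl
countFalse-cong {suc d} f≗g =
  cong₂ (λ b c → if b then inject₁ c else suc c) (f≗g zero) (countFalse-cong (f≗g ∘ suc))

countFalse-allFalse : ∀ {d} {f : Fin d → Bool} → (∀ i → f i ≡ false) → toℕ (countFalse f) ≡ d
countFalse-allFalse {zero}      _    = refl
countFalse-allFalse {suc d} {f} allF rewrite allF zero = cong suc (countFalse-allFalse (allF ∘ suc))

threshold : ∀ {d} → ℕ → Fin d → Bool
threshold {d} m i = toℕ i + m <ᵇ d

threshold-antitone : ∀ {d} (i j : Fin d) {m m′} → toℕ i ≤ toℕ j → m ≤ m′ →
                     T (threshold m′ j) → T (threshold m i)
threshold-antitone {d} i j {m′ = m′} i≤j m≤m′ h =
  <⇒<ᵇ (≤-<-trans (+-mono-≤ i≤j m≤m′) (<ᵇ⇒< (toℕ j + m′) d h))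

threshold-beyond : ∀ {d} (i : Fin d) → threshold d i ≡ false
threshold-beyond {d} i = ¬T⇒≡false (λ h → <⇒≱ (<ᵇ⇒< _ _ h) (m≤n+m d (toℕ i)))

countFalse-threshold : ∀ {d} m → m ≤ d → toℕ (countFalse (threshold {d} m)) ≡ m
countFalse-threshold {zero}  zero z≤n = refl
countFalse-threshold {suc d} m m≤1+d with m≤n⇒m<n∨m≡n m≤1+d
... | inj₁ m<1+d rewrite Equivalence.to T-≡ (<⇒<ᵇ m<1+d) =
  trans (toℕ-inject₁ _) (countFalse-threshold m (s≤s⁻¹ m<1+d))
... | inj₂ refl = countFalse-allFalse threshold-beyond

threshold-reflects-≤ : ∀ {d} m m′ → m ≤ d →
                       (∀ (i : Fin d) → T (threshold m′ i) → T (threshold m i)) → m ≤ m′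
threshold-reflects-≤ {d} m m′ m≤d h with m′ <? d
... | no  m′≮d = ≤-trans m≤d (≮⇒≥ m′≮d)
... | yes m′<d = s≤s⁻¹ (+-cancelˡ-< t m (suc m′) (subst (t + m <_) (sym t+1+m′≡d) t+m<d))
  where
  -- test at the last index where threshold m′ holds
  t : ℕ
  t = d ∸ suc m′
  t+1+m′≡d : t + suc m′ ≡ d
  t+1+m′≡d = m∸n+n≡m m′<d
  i : Fin d
  i = fromℕ< (∸-monoʳ-< z<s m′<d)
  toℕ-i : toℕ i ≡ t
  toℕ-i = toℕ-fromℕ< (∸-monoʳ-< z<s m′<d)
  m′-holds : T (threshold m′ i)
  m′-holds = <⇒<ᵇ (subst (λ x → x + m′ < d) (sym toℕ-i)
                         (subst (t + m′ <_) t+1+m′≡d (+-monoʳ-< t (n<1+n m′))))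
  t+m<d : t + m < d
  t+m<d = subst (λ x → x + m < d) toℕ-i (<ᵇ⇒< _ _ (h i m′-holds))

DownClosed : ∀ {d} → (Fin d → Bool) → Set
DownClosed f = ∀ i j → toℕ j ≡ suc (toℕ i) → T (f j) → T (f i)

DownClosed-suc : ∀ {d} {f : Fin (suc d) → Bool} → DownClosed f → DownClosed (f ∘ suc)
DownClosed-suc dc i j j≡1+i = dc (suc i) (suc j) (cong suc j≡1+i)

DownClosed-zero : ∀ {d} {f : Fin (suc d) → Bool} → DownClosed f → ∀ i → T (f i) → T (f zero)
DownClosed-zero         dc zero    fi = fi
DownClosed-zero {suc d} dc (suc i) fi =
  dc zero (suc zero) refl (DownClosed-zero (DownClosed-suc dc) i fi)

DownClosed-allFalse : ∀ {d} {f : Fin (suc d) → Bool} → DownClosed f → f zero ≡ false →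
                      ∀ i → f i ≡ false
DownClosed-allFalse dc f₀ i = ¬T⇒≡false (subst T f₀ ∘ DownClosed-zero dc i)

threshold-DownClosed : ∀ {d} m → DownClosed (threshold {d} m)
threshold-DownClosed m i j j≡1+i =
  threshold-antitone i j (subst (toℕ i ≤_) (sym j≡1+i) (n≤1+n (toℕ i))) ≤-refl

DownClosed⇒threshold : ∀ {d} {f : Fin d → Bool} → DownClosed f →
                       ∀ i → f i ≡ threshold (toℕ (countFalse f)) i
DownClosed⇒threshold {suc d} {f} dc i with f zero in f₀
... | true rewrite toℕ-inject₁ (countFalse (f ∘ suc)) = atTrue i
  where
  atTrue : ∀ i → f i ≡ threshold {suc d} (toℕ (countFalse (f ∘ suc))) i
  atTrue zero    =
    trans f₀ (sym (Equivalence.to T-≡ (<⇒<ᵇ (s≤s (toℕ≤pred[n] (countFalse (f ∘ suc)))))))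
  atTrue (suc i) = DownClosed⇒threshold (DownClosed-suc dc) i
... | false rewrite countFalse-allFalse (DownClosed-allFalse dc f₀ ∘ suc) =
  trans (DownClosed-allFalse dc f₀ i) (sym (threshold-beyond i))

module _ {m d : ℕ} where

  private
    Iterated : Vec (List ℕ) d → Set
    Iterated = IsIteratedComposition (suc m) d

  column : Vec (List ℕ) d → Fin m → Fin d → Bool
  column v k i = cutAt (lookup v i) k

  encode : Vec (List ℕ) d → Vec (Fin (suc d)) m
  encode v = tabulate (countFalse ∘ column v)

  thresholdCuts : Vec (Fin (suc d)) m → Fin d → Vec Bool m
  thresholdCuts f i = tabulate λ k → threshold (toℕ (lookup f k)) i

  decode : Vec (Fin (suc d)) m → Vec (List ℕ) d
  decode f = tabulate (fromCuts ∘ thresholdCuts f)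

  column-DownClosed : ∀ v → Iterated v → ∀ k → DownClosed (column v k)
  column-DownClosed v (comp , chain) k i j j≡1+i = ⪯⇒cutAt⊇ (comp i) (comp j) (chain i j j≡1+i) k

  column-threshold : ∀ v → Iterated v →
                     ∀ k i → column v k i ≡ threshold (toℕ (lookup (encode v) k)) i
  column-threshold v iv k i =
    trans (DownClosed⇒threshold (column-DownClosed v iv k) i)
          (cong (λ c → threshold (toℕ c) i) (sym (lookup∘tabulate (countFalse ∘ column v) k)))

  column-decode : ∀ f k i → column (decode f) k i ≡ threshold (toℕ (lookup f k)) i
  column-decode f k i = begin
    cutAt (lookup (decode f) i) k          ≡⟨ cong (λ c → cutAt c k) (lookup∘tabulate _ i) ⟩
    cutAt (fromCuts (thresholdCuts f i)) k ≡⟨ cutAt-fromCuts (thresholdCuts f i) k ⟩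
    lookup (thresholdCuts f i) k           ≡⟨ lookup∘tabulate _ k ⟩
    threshold (toℕ (lookup f k)) i         ∎
    where open ≡-Reasoning

  decode-Iterated : ∀ f → Iterated (decode f)
  decode-Iterated f = comp , λ i j j≡1+i → cutAt⊇⇒⪯ (comp i) (comp j) λ k →
    subst T (sym (column-decode f k i)) ∘ threshold-DownClosed _ i j j≡1+i ∘
    subst T (column-decode f k j)
    where
    comp : ∀ i → IsComposition (suc m) (lookup (decode f) i)
    comp i = subst (IsComposition (suc m)) (sym (lookup∘tabulate _ i))
                   (fromCuts-isComposition (thresholdCuts f i))

  encode-decode : ∀ f → encode (decode f) ≡ f
  encode-decode f = trans (tabulate-cong λ k → toℕ-injective (trans
    (cong toℕ (countFalse-cong (column-decode f k)))
    (countFalse-threshold _ (toℕ≤pred[n] (lookup f k))))) (tabulate∘lookup f)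

  decode-encode : ∀ v → Iterated v → decode (encode v) ≡ v
  decode-encode v iv = trans (tabulate-cong λ i →
    fromCuts-cutAt (thresholdCuts (encode v) i) (proj₁ iv i) λ k →
      trans (column-threshold v iv k i) (sym (lookup∘tabulate _ k))) (tabulate∘lookup v)

  encode-mono : ∀ v w → Iterated v → Iterated w → v ≤C w → encode v ≤P encode w
  encode-mono v w iv iw v≤w k = threshold-reflects-≤ _ _ (toℕ≤pred[n] _) λ i →
    subst T (column-threshold v iv k i) ∘ ⪯⇒cutAt⊇ (proj₁ iv i) (proj₁ iw i) (v≤w i) k ∘
    subst T (sym (column-threshold w iw k i))

  encode-reflects : ∀ v w → Iterated v → Iterated w → encode v ≤P encode w → v ≤C w
  encode-reflects v w iv iw ev≤ew i = cutAt⊇⇒⪯ (proj₁ iv i) (proj₁ iw i) λ k →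
    subst T (sym (column-threshold v iv k i)) ∘ threshold-antitone i i ≤-refl (ev≤ew k) ∘
    subst T (column-threshold w iw k i)

proposition3p11 : (n d : ℕ) → 1 ≤ n → 1 ≤ d →
    OrderIso {Vec (List ℕ) d} {Vec (Fin (suc d)) (n ∸ 1)}
    (IsIteratedComposition n d) _≤C_ _≤P_
proposition3p11 (suc m) d _ _ = record
  { to      = λ v _ → encode v
  ; from    = decode
  ; from-P  = decode-Iterated
  ; from-to = decode-encode
  ; to-from = encode-decode
  ; to-mono = encode-mono
  ; to-refl = encode-reflects
  }
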